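{- Let $\lambda\vdash m$ and $\mu\vdash n$ be partitions with $l=l(\lambda)$, $l'=l(\mu)$, and let $\nu_0=(m\mu_1,\dots,m\mu_{l'-1},\,m(\mu_{l'}-1)+\lambda_1,\,\lambda_2,\dots,\lambda_l)$. Then (1) $\max\{\nu\vdash mn : Y_{\lambda[\mu]}^{\nu}\neq 0\}=\nu_0$, the maximum taken with respect to the reverse lexicographic order; (2) $Y_{\lambda[\mu]}^{\nu_0}=1$.
   Context: Let $\mathrm{SSTab}(\mu)$ be the set of semistandard Young tableaux of shape $\mu$ with positive integer entries. The word of such a tableau is obtained by reading its entries row by row, left to right, from top row to bottom row; $\mathrm{SSTab}(\mu)$ is totally ordered by comparing words lexicographically. A semistandard tableau of shape $\lambda[\mu]$ is a map from the cells of the Young diagram of $\lambda$ to $\mathrm{SSTab}(\mu)$ that is weakly increasing along rows and strictly increasing down columns with respect to this total order; its weight $(\nu_1,\nu_2,\dots)$ records in $\nu_k$ the total number of entries equal to $k$ in all $m$ tableaux. $Y_{\lambda[\mu]}^{\nu}$ is the number of semistandard tableaux of shape $\lambda[\mu]$ with weight $\nu$. The reverse lexicographic order on partitions: $\kappa>\nu$ iff at the first index $i$ with $\kappa_i\neq\nu_i$ one has $\kappa_i>\nu_i$. -}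

module Defs where

open import Data.Nat using (ℕ; zero; suc; _+_; _*_; _∸_; _≤_; _<_; _≟_)
open import Data.List using (List; []; _∷_; map; concat; length)
open import Data.Nat.ListAction using (sum)
open import Data.List.Relation.Unary.All using (All)
open import Data.Product using (_×_; ∃-syntax)
open import Data.Sum using (_⊎_)
open import Data.Unit using (⊤)
open import Data.Empty using (⊥)
open import Relation.Nullary using (does)
open import Data.Bool using (if_then_else_)
open import Relation.Binary.PropositionalEquality using (_≡_)

Adjacent : {A : Set} → (A → A → Set) → List A → Set
Adjacent R [] = ⊤
Adjacent R (x ∷ []) = ⊤
Adjacent R (x ∷ y ∷ xs) = R x y × Adjacent R (y ∷ xs)

IsPartition : List ℕ → Set
IsPartition ν = All (λ x → 1 ≤ x) ν × Adjacent (λ x y → y ≤ x) ν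

_⊢_ : List ℕ → ℕ → Set
ν ⊢ k = IsPartition ν × sum ν ≡ k

-- i-th part (0-indexed), 0 beyond the length
part : List ℕ → ℕ → ℕ
part [] i = 0
part (x ∷ xs) zero = x
part (x ∷ xs) (suc i) = part xs i

_>rl_ : List ℕ → List ℕ → Set
κ >rl ν = ∃[ i ] ((∀ j → j < i → part κ j ≡ part ν j) × part ν i < part κ i)

-- Generic semistandard-tableau condition over an ordered alphabet.
-- A tableau is a list of rows (top to bottom), each a list of entries.

ColStrict : {A : Set} → (A → A → Set) → List A → List A → Set
ColStrict S _ [] = ⊤
ColStrict S [] (b ∷ r') = ⊥
ColStrict S (a ∷ r) (b ∷ r') = S a b × ColStrict S r r'

IsSST : {A : Set} → (A → A → Set) → (A → A → Set) → List ℕ → List (List A) → Set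
IsSST W S sh t = map length t ≡ sh × All (Adjacent W) t × Adjacent (ColStrict S) t

IsSSYT : List ℕ → List (List ℕ) → Set
IsSSYT μ t = All (All (λ x → 1 ≤ x)) t × IsSST _≤_ _<_ μ t

word : List (List ℕ) → List ℕ
word = concat

_<lex_ : List ℕ → List ℕ → Set
[] <lex [] = ⊥
[] <lex (b ∷ y) = ⊤
(a ∷ x) <lex [] = ⊥
(a ∷ x) <lex (b ∷ y) = a < b ⊎ (a ≡ b × x <lex y)

_<T_ : List (List ℕ) → List (List ℕ) → Set
s <T t = word s <lex word t

_≤T_ : List (List ℕ) → List (List ℕ) → Set
s ≤T t = s ≡ t ⊎ s <T t

IsPlethTab : List ℕ → List ℕ → List (List (List (List ℕ))) → Set
IsPlethTab λ' μ P = All (All (IsSSYT μ)) P × IsSST _≤T_ _<T_ λ' P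

occ : ℕ → List ℕ → ℕ
occ k [] = 0
occ k (x ∷ xs) = if does (x ≟ k) then suc (occ k xs) else occ k xs

wt : ℕ → List (List (List (List ℕ))) → ℕ
wt k P = sum (map (λ row → sum (map (λ t → sum (map (occ k) t)) row)) P)

-- P has weight ν (ν_k = number of entries equal to k, k ≥ 1)
HasWeight : List (List (List (List ℕ))) → List ℕ → Set
HasWeight P ν = ∀ k → wt (suc k) P ≡ part ν k

-- ν₀ = (mμ₁, …, mμ_{l'-1}, m(μ_{l'}-1)+λ₁, λ₂, …, λ_l)

nu0aux : ℕ → List ℕ → ℕ → List ℕ → List ℕ
nu0aux m [] l1 lrest = []
nu0aux m (x ∷ []) l1 lrest = (m * (x ∸ 1) + l1) ∷ lrest
nu0aux m (x ∷ y ∷ r) l1 lrest = m * x ∷ nu0aux m (y ∷ r) l1 lrest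

nu0 : List ℕ → List ℕ → List ℕ
nu0 [] μ = []
nu0 (l1 ∷ lrest) μ = nu0aux (l1 + sum lrest) μ l1 lrest

module Submission where

-- Lemma 4.3.  For μ = (μ₁, …, μ_{l'}) and y ≥ l' let S y be the tableau of
-- shape μ whose i-th row is constant i, except that its very last entry is y.
-- Every tableau of shape μ has word ≥ word (S l'), and word (S (y+1)) is the
-- successor of word (S y) among words of length |μ|; so, going down the
-- columns of a tableau Q of shape λ[μ], every cell of row j holds some T with
-- word (S (l'+j)) ≤ word T.  Key local fact: then T = S y or the content of T
-- is lexicographically smaller, since for sorted rows the lexicographic order
-- on rows reverses into the lexicographic order on multiplicities.  Adding up
-- over all cells, Q = P₀ (the tableau with S (l'+j) in each cell of row j) or
-- the weight of Q is lexicographically below that of P₀, which is ν₀.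

open import Defs
open import Data.Nat using (ℕ; zero; suc; _+_; _*_; _∸_; _≤_; _<_; _≡ᵇ_; z≤n; s≤s)
open import Data.Bool using (true; false; T)
open import Data.Nat.Properties
open import Data.Nat.ListAction using (sum)
open import Data.List using (List; []; _∷_; map; concat; length; replicate; _++_)
open import Data.List.Properties
  using (length-++; length-replicate; ++-assoc; ++-identityʳ; ∷-injective; ∷-injectiveˡ; ∷-injectiveʳ)
open import Data.List.Relation.Unary.All as All using (All; []; _∷_)
open import Data.List.Relation.Unary.All.Properties using (replicate⁺; ++⁺)
open import Data.List.Relation.Unary.Any using (here; there)
open import Data.List.Membership.Propositional using (_∈_)
open import Data.Product as Prod using (_×_; ∃-syntax; _,_; proj₁; proj₂; uncurry)
open import Data.Sum as Sum using (_⊎_; inj₁; inj₂)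
open import Data.Unit using (⊤; tt)
open import Data.Empty using (⊥-elim)
open import Function using (_∘_)
open import Relation.Nullary using (¬_)
open import Relation.Binary.PropositionalEquality
open import Relation.Binary.Definitions using (tri<; tri≈; tri>)
open import Data.Nat.Solver using (module +-*-Solver)
open +-*-Solver using (solve; _:+_; _:=_)

_≺[_]_ : (ℕ → ℕ) → ℕ → (ℕ → ℕ) → Set
f ≺[ v ] g = (∀ u → u < v → f u ≡ g u) × f v < g v

-- The lexicographic order on count functions; on weights k ↦ ν_k it is the
-- reverse lexicographic order of the paper.
_≺_ : (ℕ → ℕ) → (ℕ → ℕ) → Set
f ≺ g = ∃[ v ] (f ≺[ v ] g)

_⊕_ : (ℕ → ℕ) → (ℕ → ℕ) → ℕ → ℕ
(f ⊕ g) v = f v + g v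

≺[]-cong : ∀ {f f' g g' v} → f ≗ f' → g ≗ g' → f ≺[ v ] g → f' ≺[ v ] g'
≺[]-cong {v = v} f≗f' g≗g' (agree , lt) =
  (λ u u<v → trans (sym (f≗f' u)) (trans (agree u u<v) (g≗g' u))) , subst₂ _<_ (f≗f' v) (g≗g' v) lt

≺[]-addˡ : ∀ {f g v} h → f ≺[ v ] g → (h ⊕ f) ≺[ v ] (h ⊕ g)
≺[]-addˡ {v = v} h (agree , lt) = (λ u u<v → cong (h u +_) (agree u u<v)) , +-monoʳ-< (h v) lt

≺[]-addʳ : ∀ {f g f' g' v} → f ≺[ v ] g → (∀ u → u ≤ v → f' u ≡ g' u) → (f ⊕ f') ≺[ v ] (g ⊕ g')
≺[]-addʳ {v = v} (agree , lt) agree' =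
  (λ u u<v → cong₂ _+_ (agree u u<v) (agree' u (<⇒≤ u<v))) , +-mono-<-≤ lt (≤-reflexive (agree' v ≤-refl))

≺-cong : ∀ {f f' g g'} → f ≗ f' → g ≗ g' → f ≺ g → f' ≺ g'
≺-cong f≗f' g≗g' (v , lt) = v , ≺[]-cong f≗f' g≗g' lt

≺-irrefl : ∀ {f g} → f ≗ g → ¬ (f ≺ g)
≺-irrefl f≗g (v , _ , lt) = <-irrefl (f≗g v) lt

≺-asym : ∀ {f g} → f ≺ g → ¬ (g ≺ f)
≺-asym (v , agree , lt) (w , agree' , lt') with <-cmp v w
... | tri< v<w _ _ = <-irrefl (sym (agree' v v<w)) lt
... | tri≈ _ refl _ = <-asym lt lt'
... | tri> _ _ w<v = <-irrefl (sym (agree w w<v)) lt'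

≺-tail : ∀ {f g} → f 0 ≡ g 0 → f ≺ g → (f ∘ suc) ≺ (g ∘ suc)
≺-tail eq₀ (zero , _ , lt) = ⊥-elim (<-irrefl eq₀ lt)
≺-tail eq₀ (suc v , agree , lt) = v , (λ u u<v → agree (suc u) (s≤s u<v)) , lt

-- Sums of lexicographically smaller counts are smaller: the earlier witness wins.
≺-⊕ : ∀ {f g f' g'} → f ≺ g → f' ≺ g' → (f ⊕ f') ≺ (g ⊕ g')
≺-⊕ {f} {g} {f'} {g'} (v , agree , lt) (v' , agree' , lt') with <-cmp v v'
... | tri< v<v' _ _ = v , ≺[]-addʳ (agree , lt) (λ u u≤v → agree' u (≤-<-trans u≤v v<v'))
... | tri≈ _ refl _ = v , (λ u u<v → cong₂ _+_ (agree u u<v) (agree' u u<v)) , +-mono-< lt lt'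
... | tri> _ _ v'<v =
  v' , ≺[]-cong (λ u → +-comm (f' u) (f u)) (λ u → +-comm (g' u) (g u))
         (≺[]-addʳ (agree' , lt') (λ u u≤v' → agree u (≤-<-trans u≤v' v'<v)))

_⊑⟨_⟩_ : {A : Set} → A → (A → ℕ → ℕ) → A → Set
a ⊑⟨ c ⟩ a₀ = a ≡ a₀ ⊎ c a ≺ c a₀

total : {A : Set} → (A → ℕ → ℕ) → List A → ℕ → ℕ
total c as v = sum (map (λ a → c a v) as)

⊑-∷ : {A : Set} {c : A → ℕ → ℕ} {a a₀ : A} {as as₀ : List A} →
  a ⊑⟨ c ⟩ a₀ → as ⊑⟨ total c ⟩ as₀ → (a ∷ as) ⊑⟨ total c ⟩ (a₀ ∷ as₀)
⊑-∷ (inj₁ refl) (inj₁ refl) = inj₁ refl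
⊑-∷ {c = c} {a = a} (inj₁ refl) (inj₂ (v , lt)) = inj₂ (v , ≺[]-addˡ (c a) lt)
⊑-∷ (inj₂ (v , lt)) (inj₁ refl) = inj₂ (v , ≺[]-addʳ lt (λ _ _ → refl))
⊑-∷ (inj₂ lt) (inj₂ lt') = inj₂ (≺-⊕ lt lt')

⊑-replicate : {A : Set} {c : A → ℕ → ℕ} {a₀ : A} {as : List A} →
  All (λ a → a ⊑⟨ c ⟩ a₀) as → as ⊑⟨ total c ⟩ replicate (length as) a₀
⊑-replicate [] = inj₁ refl
⊑-replicate (p ∷ ps) = ⊑-∷ p (⊑-replicate ps)

total-replicate : {A : Set} (c : A → ℕ → ℕ) → ∀ n a v → total c (replicate n a) v ≡ n * c a v
total-replicate c zero a v = refl
total-replicate c (suc n) a v = cong (c a v +_) (total-replicate c n a v)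

total-zero : {A : Set} {c : A → ℕ → ℕ} {v : ℕ} {as : List A} → All (λ a → c a v ≡ 0) as → total c as v ≡ 0
total-zero [] = refl
total-zero {c = c} {v} (z ∷ zs) = cong₂ _+_ z (total-zero {c = c} {v} zs)

>rl⇒≺ : ∀ {κ ν} → κ >rl ν → part ν ≺ part κ
>rl⇒≺ (i , agree , lt) = i , (λ j j<i → sym (agree j j<i)) , lt

_≤lex_ : List ℕ → List ℕ → Set
x ≤lex y = x ≡ y ⊎ x <lex y

<lex-trans : ∀ x y z → x <lex y → y <lex z → x <lex z
<lex-trans [] (b ∷ y) (c ∷ z) _ _ = tt
<lex-trans (a ∷ x) (b ∷ y) (c ∷ z) (inj₁ a<b) (inj₁ b<c) = inj₁ (<-trans a<b b<c)
<lex-trans (a ∷ x) (b ∷ y) (c ∷ z) (inj₁ a<b) (inj₂ (refl , _)) = inj₁ a<b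
<lex-trans (a ∷ x) (b ∷ y) (c ∷ z) (inj₂ (refl , _)) (inj₁ b<c) = inj₁ b<c
<lex-trans (a ∷ x) (b ∷ y) (c ∷ z) (inj₂ (refl , x<y)) (inj₂ (refl , y<z)) = inj₂ (refl , <lex-trans x y z x<y y<z)

≤lex-<lex-trans : ∀ x y z → x ≤lex y → y <lex z → x <lex z
≤lex-<lex-trans x .x z (inj₁ refl) y<z = y<z
≤lex-<lex-trans x y z (inj₂ x<y) y<z = <lex-trans x y z x<y y<z

<lex-++ˡ : ∀ B {X Y} → X <lex Y → (B ++ X) <lex (B ++ Y)
<lex-++ˡ [] lt = lt
<lex-++ˡ (b ∷ B) lt = inj₂ (refl , <lex-++ˡ B lt)

<lex-++ : ∀ B R {X Y} → length B ≡ length R → B <lex R → (B ++ X) <lex (R ++ Y)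
<lex-++ [] [] _ ()
<lex-++ [] (r ∷ R) () _
<lex-++ (b ∷ B) [] () _
<lex-++ (b ∷ B) (r ∷ R) _ (inj₁ b<r) = inj₁ b<r
<lex-++ (b ∷ B) (r ∷ R) e (inj₂ (b≡r , lt)) = inj₂ (b≡r , <lex-++ B R (suc-injective e) lt)

≤lex-++ : ∀ B R {X Y} → length B ≡ length R → B ≤lex R → X ≤lex Y → (B ++ X) ≤lex (R ++ Y)
≤lex-++ B .B e (inj₁ refl) (inj₁ refl) = inj₁ refl
≤lex-++ B .B e (inj₁ refl) (inj₂ lt) = inj₂ (<lex-++ˡ B lt)
≤lex-++ B R e (inj₂ lt) _ = inj₂ (<lex-++ B R e lt)

∷-split : ∀ b {B R X Y} → B <lex R ⊎ (B ≡ R × X ≤lex Y) → (b ∷ B) <lex (b ∷ R) ⊎ (b ∷ B ≡ b ∷ R × X ≤lex Y)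
∷-split b = Sum.map (λ lt → inj₂ (refl , lt)) (Prod.map₁ (cong (b ∷_)))

≤lex-split : ∀ B R {X Y} → length B ≡ length R → (B ++ X) ≤lex (R ++ Y) → B <lex R ⊎ (B ≡ R × X ≤lex Y)
≤lex-split [] [] _ h = inj₂ (refl , h)
≤lex-split [] (r ∷ R) () _
≤lex-split (b ∷ B) [] () _
≤lex-split (b ∷ B) (r ∷ R) e (inj₁ eq) with ∷-injective eq
... | refl , eq' = ∷-split b (≤lex-split B R (suc-injective e) (inj₁ eq'))
≤lex-split (b ∷ B) (r ∷ R) e (inj₂ (inj₁ b<r)) = inj₁ (inj₁ b<r)
≤lex-split (b ∷ B) (r ∷ R) e (inj₂ (inj₂ (refl , lt))) = ∷-split b (≤lex-split B R (suc-injective e) (inj₂ lt))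

lex-next : ∀ p y w → (p ++ y ∷ []) <lex w → length w ≡ length (p ++ y ∷ []) → (p ++ suc y ∷ []) ≤lex w
lex-next [] y (z ∷ []) (inj₁ y<z) _ with m≤n⇒m<n∨m≡n y<z
... | inj₁ y+1<z = inj₂ (inj₁ y+1<z)
... | inj₂ refl = inj₁ refl
lex-next [] y (z ∷ []) (inj₂ (_ , ())) _
lex-next [] y (z ∷ _ ∷ _) _ ()
lex-next (a ∷ p) y (z ∷ w) (inj₁ a<z) _ = inj₂ (inj₁ a<z)
lex-next (a ∷ p) y (.a ∷ w) (inj₂ (refl , lt)) e with lex-next p y w lt (suc-injective e)
... | inj₁ eq = inj₁ (cong (a ∷_) eq)
... | inj₂ lt' = inj₂ (inj₂ (refl , lt'))

cnt : List ℕ → ℕ → ℕ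
cnt R v = occ v R

occ-hit : ∀ v xs → occ v (v ∷ xs) ≡ suc (occ v xs)
occ-hit v xs with v ≡ᵇ v in eq
... | true = refl
... | false = ⊥-elim (subst T eq (≡⇒≡ᵇ v v refl))

occ-miss : ∀ {x v} xs → x ≢ v → occ v (x ∷ xs) ≡ occ v xs
occ-miss {x} {v} xs x≢v with x ≡ᵇ v in eq
... | true = ⊥-elim (x≢v (≡ᵇ⇒≡ x v (subst T (sym eq) tt)))
... | false = refl

occ-++ : ∀ v A B → occ v (A ++ B) ≡ occ v A + occ v B
occ-++ v [] B = refl
occ-++ v (a ∷ A) B with a ≡ᵇ v
... | true = cong suc (occ-++ v A B)
... | false = occ-++ v A B

occ-replicate-hit : ∀ {b v} n → b ≡ v → occ v (replicate n b) ≡ n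
occ-replicate-hit zero _ = refl
occ-replicate-hit {b} (suc n) refl = trans (occ-hit b (replicate n b)) (cong suc (occ-replicate-hit n refl))

occ-replicate-miss : ∀ {b v} n → b ≢ v → occ v (replicate n b) ≡ 0
occ-replicate-miss zero _ = refl
occ-replicate-miss {b} (suc n) b≢v = trans (occ-miss (replicate n b) b≢v) (occ-replicate-miss n b≢v)

occ-below : ∀ {u c} R → u < c → All (c ≤_) R → occ u R ≡ 0
occ-below [] _ [] = refl
occ-below (x ∷ R) u<c (c≤x ∷ bound) = trans (occ-miss R (>⇒≢ (<-≤-trans u<c c≤x))) (occ-below R u<c bound)

∈-replicate : ∀ {v b : ℕ} n → v ∈ replicate n b → v ≡ b
∈-replicate (suc n) (here v≡b) = v≡b
∈-replicate (suc n) (there v∈) = ∈-replicate n v∈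

adjacent-tail : {A : Set} {R : A → A → Set} {x : A} (xs : List A) → Adjacent R (x ∷ xs) → Adjacent R xs
adjacent-tail [] _ = tt
adjacent-tail (_ ∷ _) (_ , adj) = adj

adjacent-replicate : {A : Set} {R : A → A → Set} (n : ℕ) (a : A) → R a a → Adjacent R (replicate n a)
adjacent-replicate zero a _ = tt
adjacent-replicate (suc zero) a _ = tt
adjacent-replicate (suc (suc n)) a r = r , adjacent-replicate (suc n) a r

Sorted : List ℕ → Set
Sorted = Adjacent _≤_

Decreasing : List ℕ → Set
Decreasing = Adjacent (λ a c → c ≤ a)

sorted-min : ∀ r R → Sorted (r ∷ R) → All (r ≤_) (r ∷ R)
sorted-min r [] _ = ≤-refl ∷ []
sorted-min r (s ∷ R) (r≤s , sorted) = ≤-refl ∷ All.map (≤-trans r≤s) (sorted-min s R sorted)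

sorted-snoc : ∀ n b y → b ≤ y → Sorted (replicate n b ++ y ∷ [])
sorted-snoc zero b y _ = tt
sorted-snoc (suc zero) b y b≤y = b≤y , tt
sorted-snoc (suc (suc n)) b y b≤y = ≤-refl , sorted-snoc (suc n) b y b≤y

sorted-lex-counts : ∀ B R → Sorted B → Sorted R → length B ≡ length R → B <lex R →
  ∃[ v ] (v ∈ B × cnt R ≺[ v ] cnt B)
sorted-lex-counts [] [] _ _ _ ()
sorted-lex-counts [] (_ ∷ _) _ _ () _
sorted-lex-counts (_ ∷ _) [] _ _ () _
sorted-lex-counts (b ∷ B) (r ∷ R) sB sR _ (inj₁ b<r) =
  b , here refl ,
  (λ u u<b → trans (occ-below (r ∷ R) (<-trans u<b b<r) rMin) (sym (occ-below (b ∷ B) u<b bMin))) ,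
  subst₂ _<_ (sym (occ-below (r ∷ R) b<r rMin)) (sym (occ-hit b B)) (s≤s z≤n)
  where
  rMin : All (r ≤_) (r ∷ R)
  rMin = sorted-min r R sR
  bMin : All (b ≤_) (b ∷ B)
  bMin = sorted-min b B sB
sorted-lex-counts (b ∷ B) (.b ∷ R) sB sR e (inj₂ (refl , lt))
  with sorted-lex-counts B R (adjacent-tail B sB) (adjacent-tail R sR) (suc-injective e) lt
... | v , v∈B , fewer =
  v , there v∈B ,
  ≺[]-cong (λ u → sym (occ-++ u (b ∷ []) R)) (λ u → sym (occ-++ u (b ∷ []) B)) (≺[]-addˡ (cnt (b ∷ [])) fewer)

RowBound : ℕ → List (List ℕ) → Set
RowBound b [] = ⊤
RowBound b (R ∷ T) = All (b ≤_) R × RowBound (suc b) T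

colStrict-bound : ∀ {b} R R' → ColStrict _<_ R R' → All (b ≤_) R → All (suc b ≤_) R'
colStrict-bound R [] _ _ = []
colStrict-bound [] (c ∷ R') () _
colStrict-bound (a ∷ R) (c ∷ R') (a<c , cols) (b≤a ∷ bound) = ≤-<-trans b≤a a<c ∷ colStrict-bound R R' cols bound

colStrict-rowBound : ∀ b R T → All (b ≤_) R → Adjacent (ColStrict _<_) (R ∷ T) → RowBound b (R ∷ T)
colStrict-rowBound b R [] bound _ = bound , tt
colStrict-rowBound b R (R' ∷ T) bound (cols , adj) =
  bound , colStrict-rowBound (suc b) R' T (colStrict-bound R R' cols bound) adj

ssyt-rowBound : ∀ {μ} T → IsSSYT μ T → RowBound 1 T
ssyt-rowBound [] _ = tt
ssyt-rowBound (R ∷ T) (pos ∷ _ , _ , _ , cols) = colStrict-rowBound 1 R T pos cols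

rowBound-positive : ∀ b T → RowBound (suc b) T → All (All (1 ≤_)) T
rowBound-positive b [] _ = []
rowBound-positive b (R ∷ T) (bound , rest) =
  All.map (≤-trans (s≤s z≤n)) bound ∷ rowBound-positive (suc b) T rest

-- Count functions of a tableau, of a row of tableaux and of a plethystic
-- tableau; the last one is the weight: plethCnt P k = wt k P.
tabCnt : List (List ℕ) → ℕ → ℕ
tabCnt = total cnt

rowCnt : List (List (List ℕ)) → ℕ → ℕ
rowCnt = total tabCnt

plethCnt : List (List (List (List ℕ))) → ℕ → ℕ
plethCnt = total rowCnt

tabCnt-word : ∀ T v → tabCnt T v ≡ occ v (word T)
tabCnt-word [] v = refl
tabCnt-word (R ∷ T) v = trans (cong (occ v R +_) (tabCnt-word T v)) (sym (occ-++ v R (word T)))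

tabCnt-vanish : ∀ {u c} T → u < c → RowBound c T → tabCnt T u ≡ 0
tabCnt-vanish [] _ _ = refl
tabCnt-vanish (R ∷ T) u<c (bound , rest) = cong₂ _+_ (occ-below R u<c bound) (tabCnt-vanish T (m<n⇒m<1+n u<c) rest)

plethCnt-zero : ∀ {μ} P → All (All (IsSSYT μ)) P → plethCnt P 0 ≡ 0
plethCnt-zero P tabs = total-zero {c = rowCnt} (All.map rowCnt-zero tabs)
  where
  rowCnt-zero : ∀ {q} → All (IsSSYT _) q → rowCnt q 0 ≡ 0
  rowCnt-zero = total-zero {c = tabCnt} ∘ All.map (λ {T} sT → tabCnt-vanish T (s≤s z≤n) (ssyt-rowBound T sT))

length-word : ∀ T → length (word T) ≡ sum (map length T)
length-word [] = refl
length-word (R ∷ T) = trans (length-++ R) (cong (length R +_) (length-word T))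

lastIndex : ℕ → List ℕ → ℕ
lastIndex b [] = b
lastIndex b (x ∷ []) = b
lastIndex b (x ∷ x' ∷ r) = lastIndex (suc b) (x' ∷ r)

b≤lastIndex : ∀ b μ → b ≤ lastIndex b μ
b≤lastIndex b [] = ≤-refl
b≤lastIndex b (x ∷ []) = ≤-refl
b≤lastIndex b (x ∷ x' ∷ r) = ≤-trans (n≤1+n b) (b≤lastIndex (suc b) (x' ∷ r))

canonRow : ℕ → ℕ → List ℕ → ℕ → List ℕ
canonRow b x [] y = replicate (x ∸ 1) b ++ y ∷ []
canonRow b x (_ ∷ _) y = replicate x b

-- canon b μ y : the canonical tableau of shape μ with first row index b and last entry y;
-- S y = canon 1 μ y.
canon : ℕ → List ℕ → ℕ → List (List ℕ)
canon b [] y = []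
canon b (x ∷ r) y = canonRow b x r y ∷ canon (suc b) r y

canonPrefix : ℕ → List ℕ → List ℕ
canonPrefix b [] = []
canonPrefix b (x ∷ []) = replicate (x ∸ 1) b
canonPrefix b (x ∷ x' ∷ r) = replicate x b ++ canonPrefix (suc b) (x' ∷ r)

word-canon : ∀ b x r y → word (canon b (x ∷ r) y) ≡ canonPrefix b (x ∷ r) ++ y ∷ []
word-canon b x [] y = ++-identityʳ _
word-canon b x (x' ∷ r) y = begin
  replicate x b ++ word (canon (suc b) (x' ∷ r) y)     ≡⟨ cong (replicate x b ++_) (word-canon (suc b) x' r y) ⟩
  replicate x b ++ (canonPrefix (suc b) (x' ∷ r) ++ y ∷ []) ≡⟨ ++-assoc (replicate x b) _ (y ∷ []) ⟨
  canonPrefix b (x ∷ x' ∷ r) ++ y ∷ []                 ∎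
  where open ≡-Reasoning

canonPrefix-bound : ∀ b μ → All (b ≤_) (canonPrefix b μ)
canonPrefix-bound b [] = []
canonPrefix-bound b (x ∷ []) = replicate⁺ (x ∸ 1) ≤-refl
canonPrefix-bound b (x ∷ x' ∷ r) =
  ++⁺ (replicate⁺ x ≤-refl) (All.map (≤-trans (n≤1+n b)) (canonPrefix-bound (suc b) (x' ∷ r)))

canonRow-length : ∀ b x r y → 1 ≤ x → length (canonRow b x r y) ≡ x
canonRow-length b x [] y 1≤x = begin
  length (replicate (x ∸ 1) b ++ y ∷ []) ≡⟨ length-++ (replicate (x ∸ 1) b) ⟩
  length (replicate (x ∸ 1) b) + 1       ≡⟨ cong (_+ 1) (length-replicate (x ∸ 1)) ⟩
  x ∸ 1 + 1                              ≡⟨ m∸n+n≡m 1≤x ⟩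
  x                                      ∎
  where open ≡-Reasoning
canonRow-length b x (_ ∷ _) y _ = length-replicate x

canon-shape : ∀ b μ y → All (1 ≤_) μ → map length (canon b μ y) ≡ μ
canon-shape b [] y _ = refl
canon-shape b (x ∷ r) y (1≤x ∷ pos) = cong₂ _∷_ (canonRow-length b x r y 1≤x) (canon-shape (suc b) r y pos)

canon-rowBound : ∀ b μ y → lastIndex b μ ≤ y → RowBound b (canon b μ y)
canon-rowBound b [] y _ = tt
canon-rowBound b (x ∷ []) y b≤y = ++⁺ (replicate⁺ (x ∸ 1) ≤-refl) (b≤y ∷ []) , tt
canon-rowBound b (x ∷ x' ∷ r) y last≤y = replicate⁺ x ≤-refl , canon-rowBound (suc b) (x' ∷ r) y last≤y

canon-sorted : ∀ b μ y → lastIndex b μ ≤ y → All Sorted (canon b μ y)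
canon-sorted b [] y _ = []
canon-sorted b (x ∷ []) y b≤y = sorted-snoc (x ∸ 1) b y b≤y ∷ []
canon-sorted b (x ∷ x' ∷ r) y last≤y = adjacent-replicate x b ≤-refl ∷ canon-sorted (suc b) (x' ∷ r) y last≤y

colStrict-replicate : {A : Set} {R : A → A → Set} (n : ℕ) (s : A) (R' : List A) →
  All (R s) R' → length R' ≤ n → ColStrict R (replicate n s) R'
colStrict-replicate n s [] _ _ = tt
colStrict-replicate zero s (c ∷ R') _ ()
colStrict-replicate (suc n) s (c ∷ R') (p ∷ ps) (s≤s len) = p , colStrict-replicate n s R' ps len

canon-colStrict : ∀ b μ y → lastIndex b μ ≤ y → All (1 ≤_) μ → Decreasing μ → Adjacent (ColStrict _<_) (canon b μ y)
canon-colStrict b [] y _ _ _ = tt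
canon-colStrict b (x ∷ []) y _ _ _ = tt
canon-colStrict b (x ∷ x' ∷ r) y last≤y (_ ∷ pos) (x'≤x , dec) =
  colStrict-replicate x b _ (proj₁ (canon-rowBound (suc b) (x' ∷ r) y last≤y))
    (≤-trans (≤-reflexive (canonRow-length (suc b) x' r y (All.head pos))) x'≤x) ,
  canon-colStrict (suc b) (x' ∷ r) y last≤y pos dec

canon-ssyt : ∀ μ y → lastIndex 1 μ ≤ y → All (1 ≤_) μ → Decreasing μ → IsSSYT μ (canon 1 μ y)
canon-ssyt μ y last≤y pos dec =
  rowBound-positive 0 _ (canon-rowBound 1 μ y last≤y) ,
  canon-shape 1 μ y pos , canon-sorted 1 μ y last≤y , canon-colStrict 1 μ y last≤y pos dec

replicate-snoc : ∀ n (b : ℕ) → replicate n b ++ b ∷ [] ≡ replicate (suc n) b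
replicate-snoc zero b = refl
replicate-snoc (suc n) b = cong (b ∷_) (replicate-snoc n b)

lastRow-constant : ∀ x (b : ℕ) → 1 ≤ x → replicate (x ∸ 1) b ++ b ∷ [] ≡ replicate x b
lastRow-constant (suc x) b _ = replicate-snoc x b

replicate-≤lex : ∀ b R → All (b ≤_) R → replicate (length R) b ≤lex R
replicate-≤lex b [] [] = inj₁ refl
replicate-≤lex b (r ∷ R) (b≤r ∷ bound) with m≤n⇒m<n∨m≡n b≤r
... | inj₁ b<r = inj₂ (inj₁ b<r)
... | inj₂ refl with replicate-≤lex b R bound
...   | inj₁ eq = inj₁ (cong (b ∷_) eq)
...   | inj₂ lt = inj₂ (inj₂ (refl , lt))

canon-least : ∀ b μ T → All (1 ≤_) μ → map length T ≡ μ → RowBound b T → word (canon b μ (lastIndex b μ)) ≤lex word T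
canon-least b [] [] _ _ _ = inj₁ refl
canon-least b (x ∷ []) (R ∷ []) (1≤x ∷ _) shape (bound , _) =
  ≤lex-++ (canonRow b x [] b) R (trans (canonRow-length b x [] b 1≤x) (sym lenR))
    (subst (_≤lex R) constant (replicate-≤lex b R bound)) (inj₁ refl)
  where
  lenR : length R ≡ x
  lenR = ∷-injectiveˡ shape
  constant : replicate (length R) b ≡ canonRow b x [] b
  constant = trans (cong (λ n → replicate n b) lenR) (sym (lastRow-constant x b 1≤x))
canon-least b (x ∷ x' ∷ r) (R ∷ T) (_ ∷ pos) shape (bound , rest) with ∷-injectiveˡ shape
... | refl = ≤lex-++ (replicate (length R) b) R (length-replicate (length R)) (replicate-≤lex b R bound)
               (canon-least (suc b) (x' ∷ r) T pos (∷-injectiveʳ shape) rest)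

canonRow-length-≡ : ∀ b x r y (R : List ℕ) (T : List (List ℕ)) → 1 ≤ x → map length (R ∷ T) ≡ x ∷ r →
  length (canonRow b x r y) ≡ length R
canonRow-length-≡ b x r y R T 1≤x shape = trans (canonRow-length b x r y 1≤x) (sym (∷-injectiveˡ shape))

-- At the first row where T differs,
-- sorted-lex-counts gives a smaller multiplicity of the entry b of that row,
-- and the rows below contain no entries ≤ b.
canon-compare : ∀ b μ y T → All (1 ≤_) μ → lastIndex b μ ≤ y → map length T ≡ μ → All Sorted T → RowBound b T →
  word (canon b μ y) ≤lex word T → T ⊑⟨ tabCnt ⟩ canon b μ y
canon-compare b [] y [] _ _ _ _ _ _ = inj₁ refl
canon-compare b (x ∷ []) y (R ∷ []) (1≤x ∷ _) b≤y shape (sR ∷ _) _ h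
  with ≤lex-split (canonRow b x [] y) R (canonRow-length-≡ b x [] y R [] 1≤x shape) h
... | inj₂ (refl , _) = inj₁ refl
... | inj₁ lt with sorted-lex-counts _ R (sorted-snoc (x ∸ 1) b y b≤y) sR (canonRow-length-≡ b x [] y R [] 1≤x shape) lt
...   | v , _ , fewer = inj₂ (v , ≺[]-addʳ fewer (λ _ _ → refl))
canon-compare b (x ∷ x' ∷ r) y (R ∷ T) (1≤x ∷ pos) last≤y shape (sR ∷ sT) (_ , rest) h
  with ≤lex-split (replicate x b) R (canonRow-length-≡ b x (x' ∷ r) y R T 1≤x shape) h
... | inj₂ (refl , h') = ⊑-∷ (inj₁ refl) (canon-compare (suc b) (x' ∷ r) y T pos last≤y (∷-injectiveʳ shape) sT rest h')
... | inj₁ lt with sorted-lex-counts (replicate x b) R (adjacent-replicate x b ≤-refl) sR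
                     (canonRow-length-≡ b x (x' ∷ r) y R T 1≤x shape) lt
...   | v , v∈ , fewer = inj₂ (v , ≺[]-addʳ fewer lowerRowsAgree)
  where
  lowerRowsAgree : ∀ u → u ≤ v → tabCnt T u ≡ tabCnt (canon (suc b) (x' ∷ r) y) u
  lowerRowsAgree u u≤v = trans (tabCnt-vanish T u<b+1 rest)
                               (sym (tabCnt-vanish (canon (suc b) (x' ∷ r) y) u<b+1 (canon-rowBound (suc b) (x' ∷ r) y last≤y)))
    where
    u<b+1 : u < suc b
    u<b+1 = s≤s (≤-trans u≤v (≤-reflexive (∈-replicate x v∈)))

-- Σ_j λ_j · f (y₀ + j): the count of a list of rows whose j-th row consists of
-- λ_j objects of count f (y₀ + j).
weightedSum : (ℕ → ℕ) → ℕ → List ℕ → ℕ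
weightedSum f y₀ [] = 0
weightedSum f y₀ (a ∷ as) = a * f y₀ + weightedSum f (suc y₀) as

weightedSum-cong : ∀ {f g} → f ≗ g → ∀ y₀ lam → weightedSum f y₀ lam ≡ weightedSum g y₀ lam
weightedSum-cong f≗g y₀ [] = refl
weightedSum-cong f≗g y₀ (a ∷ as) = cong₂ _+_ (cong (a *_) (f≗g y₀)) (weightedSum-cong f≗g (suc y₀) as)

weightedSum-const+ : ∀ A g y₀ lam → weightedSum (λ z → A + g z) y₀ lam ≡ sum lam * A + weightedSum g y₀ lam
weightedSum-const+ A g y₀ [] = refl
weightedSum-const+ A g y₀ (a ∷ as) = begin
  a * (A + g y₀) + weightedSum (λ z → A + g z) (suc y₀) as
    ≡⟨ cong₂ _+_ (*-distribˡ-+ a A (g y₀)) (weightedSum-const+ A g (suc y₀) as) ⟩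
  (a * A + a * g y₀) + (sum as * A + weightedSum g (suc y₀) as)
    ≡⟨ solve 4 (λ p q s t → (p :+ q) :+ (s :+ t) := (p :+ s) :+ (q :+ t)) refl
         (a * A) (a * g y₀) (sum as * A) (weightedSum g (suc y₀) as) ⟩
  (a * A + sum as * A) + (a * g y₀ + weightedSum g (suc y₀) as)
    ≡⟨ cong (_+ (a * g y₀ + weightedSum g (suc y₀) as)) (*-distribʳ-+ A a (sum as)) ⟨
  (a + sum as) * A + (a * g y₀ + weightedSum g (suc y₀) as)
    ∎
  where open ≡-Reasoning

weightedSum-vanish : ∀ f y₀ lam → (∀ z → y₀ ≤ z → f z ≡ 0) → weightedSum f y₀ lam ≡ 0
weightedSum-vanish f y₀ [] _ = refl
weightedSum-vanish f y₀ (a ∷ as) vanish =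
  cong₂ _+_ (trans (cong (a *_) (vanish y₀ ≤-refl)) (*-zeroʳ a))
            (weightedSum-vanish f (suc y₀) as (λ z y₀<z → vanish z (<⇒≤ y₀<z)))

weightedSum-δ : ∀ {v} y₀ k lam → v ≡ y₀ + k → weightedSum (λ z → occ v (z ∷ [])) y₀ lam ≡ part lam k
weightedSum-δ y₀ k [] _ = refl
weightedSum-δ {v} y₀ zero (a ∷ as) v≡y₀+0 = begin
  a * occ v (y₀ ∷ []) + weightedSum (λ z → occ v (z ∷ [])) (suc y₀) as
    ≡⟨ cong₂ _+_ (cong (a *_) (occ-replicate-hit 1 y₀≡v)) (weightedSum-vanish _ (suc y₀) as later) ⟩
  a * 1 + 0
    ≡⟨ trans (+-identityʳ (a * 1)) (*-identityʳ a) ⟩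
  a ∎
  where
  open ≡-Reasoning
  y₀≡v : y₀ ≡ v
  y₀≡v = sym (trans v≡y₀+0 (+-identityʳ y₀))
  later : ∀ z → suc y₀ ≤ z → occ v (z ∷ []) ≡ 0
  later z y₀<z = occ-replicate-miss 1 (>⇒≢ (subst (_< z) y₀≡v y₀<z))
weightedSum-δ {v} y₀ (suc k) (a ∷ as) v≡y₀+k+1 =
  cong₂ _+_ (trans (cong (a *_) (occ-replicate-miss 1 y₀≢v)) (*-zeroʳ a))
            (weightedSum-δ (suc y₀) k as (trans v≡y₀+k+1 (+-suc y₀ k)))
  where
  y₀≢v : y₀ ≢ v
  y₀≢v y₀≡v = m≢1+m+n y₀ (trans y₀≡v (trans v≡y₀+k+1 (+-suc y₀ k)))

prefixWeight-below : ∀ m b μ lam {v} → v < b →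
  m * occ v (canonPrefix b μ) + weightedSum (λ z → occ v (z ∷ [])) (lastIndex b μ) lam ≡ 0
prefixWeight-below m b μ lam {v} v<b =
  cong₂ _+_ (trans (cong (m *_) (occ-below (canonPrefix b μ) v<b (canonPrefix-bound b μ))) (*-zeroʳ m))
            (weightedSum-vanish _ (lastIndex b μ) lam
              (λ z last≤z → occ-replicate-miss 1 (>⇒≢ (<-≤-trans v<b (≤-trans (b≤lastIndex b μ) last≤z)))))

split-count : ∀ m v A B D → m * occ v (A ++ B) + D ≡ m * occ v A + (m * occ v B + D)
split-count m v A B D = begin
  m * occ v (A ++ B) + D               ≡⟨ cong (λ t → m * t + D) (occ-++ v A B) ⟩
  m * (occ v A + occ v B) + D          ≡⟨ cong (_+ D) (*-distribˡ-+ m (occ v A) (occ v B)) ⟩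
  m * occ v A + m * occ v B + D        ≡⟨ +-assoc (m * occ v A) (m * occ v B) D ⟩
  m * occ v A + (m * occ v B + D)      ∎
  where open ≡-Reasoning

-- The weight of P₀ at v = b + k is the k-th part of ν₀: for v a row index
-- below the last one, m · μ_v from the prefix; for the last row index,
-- m (μ_{l'} - 1) + λ₁; beyond it the parts λ₂, λ₃, … from the last entries.
prefixWeight : ∀ m b x r l1 lrest k {v} → v ≡ b + k →
  m * occ v (canonPrefix b (x ∷ r)) + weightedSum (λ z → occ v (z ∷ [])) (lastIndex b (x ∷ r)) (l1 ∷ lrest)
    ≡ part (nu0aux m (x ∷ r) l1 lrest) k
prefixWeight m b x [] l1 lrest zero v≡b+0 =
  cong₂ _+_ (cong (m *_) (occ-replicate-hit (x ∸ 1) (sym (trans v≡b+0 (+-identityʳ b)))))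
            (weightedSum-δ b zero (l1 ∷ lrest) v≡b+0)
prefixWeight m b x [] l1 lrest (suc k) {v} v≡b+k+1 =
  cong₂ _+_ (trans (cong (m *_) (occ-replicate-miss (x ∸ 1) b≢v)) (*-zeroʳ m))
            (weightedSum-δ b (suc k) (l1 ∷ lrest) v≡b+k+1)
  where
  b≢v : b ≢ v
  b≢v b≡v = m≢1+m+n b (trans b≡v (trans v≡b+k+1 (+-suc b k)))
prefixWeight m b x (x' ∷ r) l1 lrest zero {v} v≡b+0 =
  trans (split-count m v (replicate x b) (canonPrefix (suc b) (x' ∷ r)) _)
    (trans (cong₂ _+_ (cong (m *_) (occ-replicate-hit x (sym v≡b)))
                      (prefixWeight-below m (suc b) (x' ∷ r) (l1 ∷ lrest) (s≤s (≤-reflexive v≡b))))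
           (+-identityʳ (m * x)))
  where
  v≡b : v ≡ b
  v≡b = trans v≡b+0 (+-identityʳ b)
prefixWeight m b x (x' ∷ r) l1 lrest (suc k) {v} v≡b+k+1 =
  trans (split-count m v (replicate x b) (canonPrefix (suc b) (x' ∷ r)) _)
    (cong₂ _+_ (trans (cong (m *_) (occ-replicate-miss x b≢v)) (*-zeroʳ m))
               (prefixWeight m (suc b) x' r l1 lrest k (trans v≡b+k+1 (+-suc b k))))
  where
  b≢v : b ≢ v
  b≢v b≡v = m≢1+m+n b (trans b≡v (trans v≡b+k+1 (+-suc b k)))

module Comparison (x : ℕ) (r : List ℕ) (μ-pos : All (1 ≤_) (x ∷ r)) (μ-dec : Decreasing (x ∷ r)) where

  μ : List ℕ
  μ = x ∷ r

  L : ℕ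
  L = lastIndex 1 μ

  S : ℕ → List (List ℕ)
  S y = canon 1 μ y

  P₀ : ℕ → List ℕ → List (List (List (List ℕ)))
  P₀ y [] = []
  P₀ y (a ∷ as) = replicate a (S y) ∷ P₀ (suc y) as

  length-word-S : ∀ y → length (word (S y)) ≡ sum μ
  length-word-S y = trans (length-word (S y)) (cong sum (canon-shape 1 μ y μ-pos))

  S-ssyt : ∀ y → L ≤ y → IsSSYT μ (S y)
  S-ssyt y L≤y = canon-ssyt μ y L≤y μ-pos μ-dec

  S<S : ∀ y → S y <T S (suc y)
  S<S y = subst₂ _<lex_ (sym (word-canon 1 x r y)) (sym (word-canon 1 x r (suc y)))
            (<lex-++ˡ (canonPrefix 1 μ) (inj₁ ≤-refl))

  S-next : ∀ y T → word (S y) <lex word T → map length T ≡ μ → word (S (suc y)) ≤lex word T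
  S-next y T lt shape =
    subst (_≤lex word T) (sym (word-canon 1 x r (suc y)))
      (lex-next (canonPrefix 1 μ) y (word T) (subst (_<lex word T) (word-canon 1 x r y) lt) sameLength)
    where
    sameLength : length (word T) ≡ length (canonPrefix 1 μ ++ y ∷ [])
    sameLength = trans (trans (length-word T) (cong sum shape))
                       (trans (sym (length-word-S y)) (cong length (word-canon 1 x r y)))

  AllAbove : ℕ → List (List (List ℕ)) → Set
  AllAbove y q = All (λ T → word (S y) ≤lex word T) q

  HeadAbove : ℕ → List (List (List (List ℕ))) → Set
  HeadAbove y [] = ⊤
  HeadAbove y (q ∷ Q) = AllAbove y q

  head-least : ∀ Q → All (All (IsSSYT μ)) Q → HeadAbove L Q
  head-least [] _ = tt
  head-least (q ∷ Q) (sq ∷ _) =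
    All.map (λ {T} sT → canon-least 1 μ T μ-pos (proj₁ (proj₂ sT)) (ssyt-rowBound T sT)) sq

  above-next : ∀ y q q' → AllAbove y q → ColStrict _<T_ q q' → All (IsSSYT μ) q' → AllAbove (suc y) q'
  above-next y q [] _ _ _ = []
  above-next y [] (T' ∷ q') _ () _
  above-next y (T ∷ q) (T' ∷ q') (above ∷ aboves) (T<T' , cols) ((_ , shape , _) ∷ ssyts) =
    S-next y T' (≤lex-<lex-trans _ _ _ above T<T') shape ∷ above-next y q q' aboves cols ssyts

  head-next : ∀ y q Q → HeadAbove y (q ∷ Q) → All (All (IsSSYT μ)) Q → Adjacent (ColStrict _<T_) (q ∷ Q) → HeadAbove (suc y) Q
  head-next y q [] _ _ _ = tt
  head-next y q (q' ∷ Q) above (sq' ∷ _) (cols , _) = above-next y q q' above cols sq'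

  cell-compare : ∀ y T → L ≤ y → IsSSYT μ T → word (S y) ≤lex word T → T ⊑⟨ tabCnt ⟩ S y
  cell-compare y T L≤y sT@(_ , shape , sorted , _) = canon-compare 1 μ y T μ-pos L≤y shape sorted (ssyt-rowBound T sT)

  row-compare : ∀ y q → L ≤ y → All (IsSSYT μ) q → AllAbove y q → q ⊑⟨ rowCnt ⟩ replicate (length q) (S y)
  row-compare y q L≤y ssyts above = ⊑-replicate (All.zipWith (uncurry (cell-compare y _ L≤y)) (ssyts , above))

  rows-compare : ∀ y Q lam → L ≤ y → map length Q ≡ lam → All (All (IsSSYT μ)) Q → Adjacent (ColStrict _<T_) Q →
    HeadAbove y Q → Q ⊑⟨ plethCnt ⟩ P₀ y lam
  rows-compare y [] [] _ _ _ _ _ = inj₁ refl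
  rows-compare y (q ∷ Q) (a ∷ as) L≤y shape (sq ∷ sQ) cols above with ∷-injectiveˡ shape
  ... | refl = ⊑-∷ (row-compare y q L≤y sq above)
                   (rows-compare (suc y) Q as (m≤n⇒m≤1+n L≤y) (∷-injectiveʳ shape) sQ (adjacent-tail Q cols)
                      (head-next y q Q above sQ cols))

  pleth-compare : ∀ lam Q → IsPlethTab lam μ Q → Q ⊑⟨ plethCnt ⟩ P₀ L lam
  pleth-compare lam Q (sQ , shape , _ , cols) = rows-compare L Q lam ≤-refl shape sQ cols (head-least Q sQ)

  P₀-tableau : ∀ y lam → L ≤ y → Decreasing lam → IsPlethTab lam μ (P₀ y lam)
  P₀-tableau y lam L≤y dec = cells y lam L≤y , shape y lam , rowsSorted y lam , columns y lam L≤y dec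
    where
    cells : ∀ y lam → L ≤ y → All (All (IsSSYT μ)) (P₀ y lam)
    cells y [] _ = []
    cells y (a ∷ as) L≤y = replicate⁺ a (S-ssyt y L≤y) ∷ cells (suc y) as (m≤n⇒m≤1+n L≤y)
    shape : ∀ y lam → map length (P₀ y lam) ≡ lam
    shape y [] = refl
    shape y (a ∷ as) = cong₂ _∷_ (length-replicate a) (shape (suc y) as)
    rowsSorted : ∀ y lam → All (Adjacent _≤T_) (P₀ y lam)
    rowsSorted y [] = []
    rowsSorted y (a ∷ as) = adjacent-replicate a (S y) (inj₁ refl) ∷ rowsSorted (suc y) as
    columns : ∀ y lam → L ≤ y → Decreasing lam → Adjacent (ColStrict _<T_) (P₀ y lam)
    columns y [] _ _ = tt
    columns y (a ∷ []) _ _ = tt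
    columns y (a ∷ a' ∷ as) L≤y (a'≤a , dec) =
      colStrict-replicate a (S y) _ (replicate⁺ a' (S<S y)) (≤-trans (≤-reflexive (length-replicate a')) a'≤a) ,
      columns (suc y) (a' ∷ as) (m≤n⇒m≤1+n L≤y) dec

  P₀-count : ∀ y lam v → plethCnt (P₀ y lam) v ≡ weightedSum (λ z → tabCnt (S z) v) y lam
  P₀-count y [] v = refl
  P₀-count y (a ∷ as) v = cong₂ _+_ (total-replicate tabCnt a (S y) v) (P₀-count (suc y) as v)

  P₀-weight : ∀ l1 lrest → HasWeight (P₀ L (l1 ∷ lrest)) (nu0 (l1 ∷ lrest) μ)
  P₀-weight l1 lrest k = begin
    plethCnt (P₀ L lam) (suc k)
      ≡⟨ P₀-count L lam (suc k) ⟩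
    weightedSum (λ z → tabCnt (S z) (suc k)) L lam
      ≡⟨ weightedSum-cong countS L lam ⟩
    weightedSum (λ z → occ (suc k) pre + occ (suc k) (z ∷ [])) L lam
      ≡⟨ weightedSum-const+ (occ (suc k) pre) _ L lam ⟩
    sum lam * occ (suc k) pre + weightedSum (λ z → occ (suc k) (z ∷ [])) L lam
      ≡⟨ prefixWeight (sum lam) 1 x r l1 lrest k refl ⟩
    part (nu0 lam μ) k ∎
    where
    open ≡-Reasoning
    lam : List ℕ
    lam = l1 ∷ lrest
    pre : List ℕ
    pre = canonPrefix 1 μ
    countS : ∀ z → tabCnt (S z) (suc k) ≡ occ (suc k) pre + occ (suc k) (z ∷ [])
    countS z = trans (tabCnt-word (S z) (suc k)) (trans (cong (occ (suc k)) (word-canon 1 x r z)) (occ-++ (suc k) pre (z ∷ [])))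

nu0aux-positive : ∀ m l1 lrest μ → 1 ≤ m → All (1 ≤_) μ → All (1 ≤_) (l1 ∷ lrest) → All (1 ≤_) (nu0aux m μ l1 lrest)
nu0aux-positive m l1 lrest [] _ _ _ = []
nu0aux-positive m l1 lrest (x ∷ []) _ _ (1≤l1 ∷ pos) = ≤-trans 1≤l1 (m≤n+m l1 (m * (x ∸ 1))) ∷ pos
nu0aux-positive m l1 lrest (x ∷ x' ∷ r) 1≤m (1≤x ∷ μ-pos) λ-pos =
  *-mono-≤ 1≤m 1≤x ∷ nu0aux-positive m l1 lrest (x' ∷ r) 1≤m μ-pos λ-pos

decreasing-raise : ∀ {l1 w} lrest → Decreasing (l1 ∷ lrest) → l1 ≤ w → Decreasing (w ∷ lrest)
decreasing-raise [] _ _ = tt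
decreasing-raise (l2 ∷ ls) (l2≤l1 , dec) l1≤w = ≤-trans l2≤l1 l1≤w , dec

merged-part-bound : ∀ m l1 x → l1 ≤ m → 1 ≤ x → m * (x ∸ 1) + l1 ≤ m * x
merged-part-bound m l1 (suc x) l1≤m _ = begin
  m * x + l1  ≤⟨ +-monoʳ-≤ (m * x) l1≤m ⟩
  m * x + m   ≡⟨ +-comm (m * x) m ⟩
  m + m * x   ≡⟨ *-suc m x ⟨
  m * suc x   ∎
  where open ≤-Reasoning

nu0aux-decreasing : ∀ m l1 lrest μ → l1 ≤ m → Decreasing (l1 ∷ lrest) → All (1 ≤_) μ → Decreasing μ →
  Decreasing (nu0aux m μ l1 lrest)
nu0aux-decreasing m l1 lrest [] _ _ _ _ = tt
nu0aux-decreasing m l1 lrest (x ∷ []) _ λ-dec _ _ = decreasing-raise lrest λ-dec (m≤n+m l1 _)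
nu0aux-decreasing m l1 lrest (x ∷ x' ∷ r) l1≤m λ-dec (_ ∷ pos) (x'≤x , dec) =
  startingBelow (m * x) x' r (*-monoʳ-≤ m x'≤x) pos dec
  where
  startingBelow : ∀ z x' r → m * x' ≤ z → All (1 ≤_) (x' ∷ r) → Decreasing (x' ∷ r) →
    Decreasing (z ∷ nu0aux m (x' ∷ r) l1 lrest)
  startingBelow z x' [] mx'≤z (1≤x' ∷ _) _ =
    ≤-trans (merged-part-bound m l1 x' l1≤m 1≤x') mx'≤z , decreasing-raise lrest λ-dec (m≤n+m l1 _)
  startingBelow z x' (x'' ∷ r) mx'≤z (_ ∷ pos) (x''≤x' , dec) =
    mx'≤z , startingBelow (m * x') x'' r (*-monoʳ-≤ m x''≤x') pos dec

nu0-partition : ∀ l1 lrest μ → IsPartition (l1 ∷ lrest) → IsPartition μ → IsPartition (nu0 (l1 ∷ lrest) μ)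
nu0-partition l1 lrest μ (λ-pos , λ-dec) (μ-pos , μ-dec) =
  nu0aux-positive (l1 + sum lrest) l1 lrest μ (≤-trans (All.head λ-pos) (m≤m+n l1 _)) μ-pos λ-pos ,
  nu0aux-decreasing (l1 + sum lrest) l1 lrest μ (m≤m+n l1 _) λ-dec μ-pos μ-dec

nu0-sum : ∀ l1 lrest x r → All (1 ≤_) (x ∷ r) → sum (nu0 (l1 ∷ lrest) (x ∷ r)) ≡ sum (l1 ∷ lrest) * sum (x ∷ r)
nu0-sum l1 lrest (suc x) [] _ = begin
  m * x + l1 + sum lrest  ≡⟨ +-assoc (m * x) l1 (sum lrest) ⟩
  m * x + m               ≡⟨ +-comm (m * x) m ⟩
  m + m * x               ≡⟨ *-suc m x ⟨
  m * suc x               ≡⟨ cong (m *_) (+-identityʳ (suc x)) ⟨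
  m * (suc x + 0)         ∎
  where
  open ≡-Reasoning
  m : ℕ
  m = l1 + sum lrest
nu0-sum l1 lrest x (x' ∷ r) (_ ∷ pos) = begin
  m * x + sum (nu0 (l1 ∷ lrest) (x' ∷ r))  ≡⟨ cong (m * x +_) (nu0-sum l1 lrest x' r pos) ⟩
  m * x + m * sum (x' ∷ r)                 ≡⟨ *-distribˡ-+ m x (sum (x' ∷ r)) ⟨
  m * sum (x ∷ x' ∷ r)                     ∎
  where
  open ≡-Reasoning
  m : ℕ
  m = l1 + sum lrest

≺-weight : ∀ {μ P P' ν ν'} → All (All (IsSSYT μ)) P → All (All (IsSSYT μ)) P' →
  HasWeight P ν → HasWeight P' ν' → plethCnt P ≺ plethCnt P' → part ν ≺ part ν'
≺-weight {P = P} {P'} tabs tabs' hw hw' lt =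
  ≺-cong hw hw' (≺-tail (trans (plethCnt-zero P tabs) (sym (plethCnt-zero P' tabs'))) lt)

lemma4p3 : (m n : ℕ) (λ' μ : List ℕ) → 0 < m → 0 < n → λ' ⊢ m → μ ⊢ n →
    (nu0 λ' μ ⊢ (m * n)
      × (∀ (ν : List ℕ) (P : List (List (List (List ℕ)))) → ν ⊢ (m * n) →
           IsPlethTab λ' μ P → HasWeight P ν → ¬ (ν >rl nu0 λ' μ)))
    × (∃[ P ] (IsPlethTab λ' μ P × HasWeight P (nu0 λ' μ)
         × (∀ Q → IsPlethTab λ' μ Q → HasWeight Q (nu0 λ' μ) → Q ≡ P)))
lemma4p3 m n [] μ 0<m _ (_ , 0≡m) _ = ⊥-elim (<-irrefl 0≡m 0<m)
lemma4p3 m n λ' [] _ 0<n _ (_ , 0≡n) = ⊥-elim (<-irrefl 0≡n 0<n)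
lemma4p3 _ _ (l1 ∷ lrest) (x ∷ r) _ _ (λ-part , refl) ((μ-pos , μ-dec) , refl) =
  ((nu0-partition l1 lrest (x ∷ r) λ-part (μ-pos , μ-dec) , nu0-sum l1 lrest x r μ-pos) , maximal) ,
  (P₀ L lam , P₀-tab , P₀-weight l1 lrest , unique)
  where
  open Comparison x r μ-pos μ-dec
  lam : List ℕ
  lam = l1 ∷ lrest
  P₀-tab : IsPlethTab lam μ (P₀ L lam)
  P₀-tab = P₀-tableau L lam ≤-refl (proj₂ λ-part)
  maximal : ∀ ν P → ν ⊢ (sum lam * sum μ) → IsPlethTab lam μ P → HasWeight P ν → ¬ (ν >rl nu0 lam μ)
  maximal ν P _ tab hw ν>ν₀ with pleth-compare lam P tab
  ... | inj₁ refl = ≺-irrefl (λ k → trans (sym (P₀-weight l1 lrest k)) (hw k)) (>rl⇒≺ {ν} {nu0 lam μ} ν>ν₀)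
  ... | inj₂ lt = ≺-asym (≺-weight {ν = ν} {nu0 lam μ} (proj₁ tab) (proj₁ P₀-tab) hw (P₀-weight l1 lrest) lt)
                         (>rl⇒≺ {ν} {nu0 lam μ} ν>ν₀)
  unique : ∀ Q → IsPlethTab lam μ Q → HasWeight Q (nu0 lam μ) → Q ≡ P₀ L lam
  unique Q tab hw with pleth-compare lam Q tab
  ... | inj₁ Q≡P₀ = Q≡P₀
  ... | inj₂ lt = ⊥-elim (≺-irrefl (λ _ → refl) (≺-weight {ν = nu0 lam μ} {nu0 lam μ} (proj₁ tab) (proj₁ P₀-tab) hw (P₀-weight l1 lrest) lt))
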